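{- Let $v=16$ (so $t=3$). There exists a balanced companion collection on $[16]$ (hence a minimal balanced $(16,8,3)$ trade) whose total set discrepancy under popularity changes of magnitude $p=1$ is at most $6$; that is, for every collection of popularity swaps of magnitude $1$ the resulting sum of discrepancies between companion sets is at most $6$.
   Context: A balanced companion collection on $[v]$, $v=4(t+1)$, is a partition of $[v]$ into $2(t+1)$ sets $S_1,\ldots,S_{2t+2}$, each of cardinality $2$, grouped into $t+1$ companion pairs $(S_{2i-1},S_{2i})$, such that $\sum_{\ell\in S_{2i-1}}\ell=\sum_{\ell\in S_{2i}}\ell$ for every $i$. It defines a minimal $(v,2(t+1),t)$ trade of volume $2^t$ with all block-sums equal: for $\varepsilon\in\{0,1\}^{t+1}$ let $B_\varepsilon=\bigcup_i S_{2i-1+\varepsilon_i}$, with $T^{(1)}$ the blocks with $\sum_i\varepsilon_i$ even and $T^{(2)}$ those with $\sum_i\varepsilon_i$ odd. A collection of popularity swaps of magnitude $1$ is a set of pairwise disjoint transpositions $(a,a+1)$ of $[v]$ (no element appears in two of them); with $\pi$ their product and $S'_j=\pi(S_j)$, the resulting discrepancy is $\sum_{i=1}^{t+1}\left|\sum_{x\in S'_{2i}}x-\sum_{x\in S'_{2i-1}}x\right|$, and the total set discrepancy is its maximum over all such swap collections. -}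

module Defs where

open import Data.Nat using (ℕ; suc; _+_; _≤_; _≟_; ∣_-_∣)
open import Data.Nat.Properties using ()
open import Data.Fin using (Fin)
open import Data.Product using (_×_; _,_; proj₁; proj₂)
open import Data.Sum using (_⊎_)
open import Data.List using (List; []; _∷_; map; foldr; upTo; concatMap)
open import Data.List.Relation.Unary.All using (All)
open import Data.List.Relation.Unary.AllPairs using (AllPairs)
open import Data.List.Relation.Binary.Permutation.Propositional using (_↭_)
open import Relation.Nullary using (yes; no)
open import Relation.Binary.PropositionalEquality using (_≡_)

-- [16] = {1,…,16}; t = 3, so t+1 = 4 companion pairs, 2(t+1) = 8 sets.

-- A 2-element set {a, b}, stored as an (unordered-in-meaning) pair.
TwoSet : Set
TwoSet = ℕ × ℕ

elems : TwoSet → List ℕ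
elems (a , b) = a ∷ b ∷ []

sum2 : TwoSet → ℕ
sum2 (a , b) = a + b

CompanionPair : Set
CompanionPair = TwoSet × TwoSet

Collection : Set
Collection = List CompanionPair

pairElems : CompanionPair → List ℕ
pairElems (S , S') = elems S Data.List.++ elems S'

range16 : List ℕ
range16 = map suc (upTo 16)

-- Balanced companion collection on [16]:
--  * exactly 4 companion pairs,
--  * the 8 sets partition [16] (their elements, listed, are a permutation of 1..16;
--    this also forces each set to have two distinct elements),
--  * each companion pair has equal sums.
record BalancedCompanion (C : Collection) : Set where
  field
    fourPairs : Data.List.length C ≡ 4
    partition : concatMap pairElems C ↭ range16
    balanced  : All (λ p → sum2 (proj₁ p) ≡ sum2 (proj₂ p)) C

-- A popularity swap of magnitude 1 is a transposition (a, a+1) of [16], 1 ≤ a ≤ 15;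
-- we store it by its lower element a.
swap : ℕ → ℕ → ℕ
swap a x with x ≟ a
... | yes _ = suc a
... | no _ with x ≟ suc a
...   | yes _ = a
...   | no _ = x

-- Two transpositions (a,a+1), (b,b+1) are disjoint iff |a - b| ≥ 2.
Disjoint : ℕ → ℕ → Set
Disjoint a b = (a + 2 ≤ b) ⊎ (b + 2 ≤ a)

record SwapCollection (sw : List ℕ) : Set where
  field
    inRange  : All (λ a → 1 ≤ a × a ≤ 15) sw
    disjoint : AllPairs Disjoint sw

-- π = product of the (commuting) transpositions
perm : List ℕ → ℕ → ℕ
perm sw x = foldr swap x sw

applySet : List ℕ → TwoSet → TwoSet
applySet sw (a , b) = perm sw a , perm sw b

discrepancy : List ℕ → Collection → ℕ
discrepancy sw [] = 0
discrepancy sw ((S , S') ∷ C) =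
  ∣ sum2 (applySet sw S') - sum2 (applySet sw S) ∣ + discrepancy sw C

{-# OPTIONS --safe #-}
module Submission where

-- A product of disjoint transpositions (a, a+1) sends x to x + 1 if x is the lower end of
-- one of them, to x − 1 if x − 1 is, and fixes x otherwise. So the
-- discrepancy of a collection only depends on the set of lower ends, a subset of {1, …, 15}
-- with no two consecutive elements. There are only 1597 such subsets, and for the
-- collection {1,16}|{8,9}, {2,7}|{4,5}, {3,14}|{6,11}, {10,15}|{12,13} every one of them
-- gives discrepancy at most 6, which is checked by evaluation.

open import Defs
open import Data.Bool using (Bool; true; false; _∧_; T; if_then_else_)
open import Data.Bool.Properties using (T-∧)
open import Data.Empty using (⊥-elim)
open import Data.List using (List; []; _∷_)
open import Data.List.Membership.Propositional using (_∈_; _∉_)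
open import Data.List.Relation.Binary.Permutation.Propositional using (↭-sym)
open import Data.List.Relation.Unary.All as All using (All; []; _∷_)
open import Data.List.Relation.Unary.AllPairs using (AllPairs; []; _∷_)
open import Data.List.Relation.Unary.Any using (here; there)
open import Data.Nat using (ℕ; zero; suc; pred; _+_; _≤_; _<_; _≤ᵇ_; _≟_; ∣_-_∣; s≤s; s≤s⁻¹)
open import Data.Nat.Properties
  using (≤-decTotalOrder; ≤ᵇ⇒≤; ≤-trans; n≤1+n; +-suc; +-identityʳ; m+1+n≰m; <⇒≱; ≤∧≢⇒<; suc-injective)
open import Data.List.Membership.DecPropositional _≟_ using (_∈?_)
open import Data.List.Sort.InsertionSort.Properties ≤-decTotalOrder using (sort-↭)
open import Data.Product using (Σ; _×_; _,_; proj₁; proj₂)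
open import Data.Sum using (inj₁; inj₂)
open import Data.Unit using (⊤; tt)
open import Data.Vec using (Vec; []; _∷_)
open import Function using (_∘_)
open import Function.Bundles using (Equivalence)
open import Relation.Nullary using (yes; no; does)
open import Relation.Binary.PropositionalEquality
  using (_≡_; _≢_; refl; sym; trans; cong; subst; ≢-sym)

Disjoint-sym : ∀ {a b} → Disjoint a b → Disjoint b a
Disjoint-sym (inj₁ p) = inj₂ p
Disjoint-sym (inj₂ p) = inj₁ p

Disjoint⇒≢ : ∀ {a b} → Disjoint a b → a ≢ b
Disjoint⇒≢ {a} (inj₁ p) refl = m+1+n≰m a p
Disjoint⇒≢ {a} (inj₂ p) refl = m+1+n≰m a p

Disjoint⇒suc≢ : ∀ {a b} → Disjoint a b → suc a ≢ b
Disjoint⇒suc≢ {a} (inj₁ p) refl = m+1+n≰m a (s≤s⁻¹ (subst (_≤ suc a) (+-suc a 1) p))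
Disjoint⇒suc≢ {a} (inj₂ p) refl = m+1+n≰m a (≤-trans (n≤1+n (a + 2)) p)

Disjoint⇒apart : ∀ {a b} → Disjoint a b → a ≢ b × a ≢ suc b
Disjoint⇒apart d = Disjoint⇒≢ d , ≢-sym (Disjoint⇒suc≢ (Disjoint-sym d))

Disjoint⇒suc-apart : ∀ {a b} → Disjoint a b → suc a ≢ b × suc a ≢ suc b
Disjoint⇒suc-apart d = Disjoint⇒suc≢ d , Disjoint⇒≢ d ∘ suc-injective

swap-lower : ∀ a → swap a a ≡ suc a
swap-lower a with a ≟ a
... | yes _ = refl
... | no a≢a = ⊥-elim (a≢a refl)

swap-upper : ∀ a → swap a (suc a) ≡ a
swap-upper a with suc a ≟ a
... | yes ()
... | no _ with suc a ≟ suc a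
...   | yes _ = refl
...   | no a≢a = ⊥-elim (a≢a refl)

swap-fixes : ∀ {a x} → x ≢ a → x ≢ suc a → swap a x ≡ x
swap-fixes {a} {x} x≢a x≢sa with x ≟ a
... | yes x≡a = ⊥-elim (x≢a x≡a)
... | no _ with x ≟ suc a
...   | yes x≡sa = ⊥-elim (x≢sa x≡sa)
...   | no _ = refl

perm-fixes : ∀ {sw x} → All (λ b → x ≢ b × x ≢ suc b) sw → perm sw x ≡ x
perm-fixes [] = refl
perm-fixes ((x≢b , x≢sb) ∷ apart) = trans (cong (swap _) (perm-fixes apart)) (swap-fixes x≢b x≢sb)

perm-lower : ∀ {sw a} → AllPairs Disjoint sw → a ∈ sw → perm sw a ≡ suc a
perm-lower {a = a} (ds ∷ _) (here refl) =
  trans (cong (swap a) (perm-fixes (All.map Disjoint⇒apart ds))) (swap-lower a)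
perm-lower (ds ∷ dss) (there a∈sw) with Disjoint⇒suc-apart (Disjoint-sym (All.lookup ds a∈sw))
... | sa≢b , sa≢sb = trans (cong (swap _) (perm-lower dss a∈sw)) (swap-fixes sa≢b sa≢sb)

perm-upper : ∀ {sw a} → AllPairs Disjoint sw → a ∈ sw → perm sw (suc a) ≡ a
perm-upper {a = a} (ds ∷ _) (here refl) =
  trans (cong (swap a) (perm-fixes (All.map Disjoint⇒suc-apart ds))) (swap-upper a)
perm-upper (ds ∷ dss) (there a∈sw) with Disjoint⇒apart (Disjoint-sym (All.lookup ds a∈sw))
... | a≢b , a≢sb = trans (cong (swap _) (perm-upper dss a∈sw)) (swap-fixes a≢b a≢sb)

perm-unmoved : ∀ {sw x} → x ∉ sw → pred x ∉ sw → perm sw x ≡ x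
perm-unmoved {x = x} x∉sw px∉sw = perm-fixes (All.tabulate apart)
  where
  apart : ∀ {b} → b ∈ _ → x ≢ b × x ≢ suc b
  apart b∈sw = (λ { refl → x∉sw b∈sw }) , (λ { refl → px∉sw b∈sw })

lower-nonadjacent : ∀ {sw x} → AllPairs Disjoint sw → x ∈ sw → suc x ∉ sw
lower-nonadjacent (_ ∷ _) (here refl) (here ())
lower-nonadjacent (ds ∷ _) (here refl) (there sx∈sw) with Disjoint⇒apart (Disjoint-sym (All.lookup ds sx∈sw))
... | _ , sx≢sx = sx≢sx refl
lower-nonadjacent (ds ∷ _) (there x∈sw) (here refl) with Disjoint⇒apart (All.lookup ds x∈sw)
... | _ , sx≢sx = sx≢sx refl
lower-nonadjacent (_ ∷ dss) (there x∈sw) (there sx∈sw) = lower-nonadjacent dss x∈sw sx∈sw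

isLower : List ℕ → ℕ → Bool
isLower sw x = does (x ∈? sw)

image : (ℕ → Bool) → ℕ → ℕ
image lower x = if lower x then suc x else if lower (pred x) then pred x else x

image-cong : ∀ {lower lower′} → (∀ y → lower y ≡ lower′ y) → ∀ x → image lower x ≡ image lower′ x
image-cong e x rewrite e x | e (pred x) = refl

perm≗image : ∀ {sw} → AllPairs Disjoint sw → ∀ x → perm sw x ≡ image (isLower sw) x
perm≗image {sw} dss x with x ∈? sw | pred x ∈? sw
... | yes x∈sw | _ = perm-lower dss x∈sw
perm≗image {sw} dss zero | no x∉sw | yes px∈sw = ⊥-elim (x∉sw px∈sw)
perm≗image {sw} dss (suc x) | no _ | yes x∈sw = perm-upper dss x∈sw
... | no x∉sw | no px∉sw = perm-unmoved x∉sw px∉sw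

isLower-nonadjacent : ∀ {sw} → AllPairs Disjoint sw → ∀ x → (isLower sw x ∧ isLower sw (suc x)) ≡ false
isLower-nonadjacent {sw} dss x with x ∈? sw | suc x ∈? sw
... | yes x∈sw | yes sx∈sw = ⊥-elim (lower-nonadjacent dss x∈sw sx∈sw)
... | yes _ | no _ = refl
... | no _ | _ = refl

restrict : (ℕ → Bool) → ℕ → (n : ℕ) → Vec Bool n
restrict m k zero = []
restrict m k (suc n) = m k ∷ restrict m (suc k) n

extend : ∀ {n} → Vec Bool n → ℕ → ℕ → Bool
extend [] k x = false
extend (b ∷ v) k x with x ≟ k
... | yes _ = b
... | no _ = extend v (suc k) x

extend-restrict : ∀ m n k x → (m x ≡ true → k ≤ x × x < k + n) → extend (restrict m k n) k x ≡ m x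
extend-restrict m zero k x inWindow with m x
... | false = refl
... | true with inWindow refl
...   | k≤x , x<k+0 = ⊥-elim (<⇒≱ (subst (x <_) (+-identityʳ k) x<k+0) k≤x)
extend-restrict m (suc n) k x inWindow with x ≟ k
... | yes refl = refl
... | no x≢k = extend-restrict m n (suc k) x inRest
  where
  inRest : m x ≡ true → suc k ≤ x × x < suc k + n
  inRest mx with inWindow mx
  ... | k≤x , x<k+sn = ≤∧≢⇒< k≤x (≢-sym x≢k) , subst (x <_) (+-suc k n) x<k+sn

NonAdjacentAfter : ∀ {n} → Bool → Vec Bool n → Set
NonAdjacentAfter b [] = ⊤
NonAdjacentAfter b (c ∷ v) = (b ∧ c) ≡ false × NonAdjacentAfter c v

NonAdjacentAfter-false : ∀ {n b} {v : Vec Bool n} → NonAdjacentAfter b v → NonAdjacentAfter false v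
NonAdjacentAfter-false {v = []} _ = tt
NonAdjacentAfter-false {v = _ ∷ _} (_ , rest) = refl , rest

restrict-nonAdjacent : ∀ {m} → (∀ y → (m y ∧ m (suc y)) ≡ false) →
                       ∀ k n → NonAdjacentAfter (m k) (restrict m (suc k) n)
restrict-nonAdjacent nonadj k zero = tt
restrict-nonAdjacent nonadj k (suc n) = nonadj k , restrict-nonAdjacent nonadj (suc k) n

allNonAdjacentAfter : ∀ n → Bool → (Vec Bool n → Bool) → Bool
allNonAdjacentAfter zero _ P = P []
allNonAdjacentAfter (suc n) true P = allNonAdjacentAfter n false (P ∘ (false ∷_))
allNonAdjacentAfter (suc n) false P =
  allNonAdjacentAfter n true (P ∘ (true ∷_)) ∧ allNonAdjacentAfter n false (P ∘ (false ∷_))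

allNonAdjacentAfter-sound : ∀ n b P → T (allNonAdjacentAfter n b P) →
                            ∀ v → NonAdjacentAfter b v → T (P v)
allNonAdjacentAfter-sound zero b P all [] _ = all
allNonAdjacentAfter-sound (suc n) true P all (true ∷ v) (() , _)
allNonAdjacentAfter-sound (suc n) true P all (false ∷ v) (_ , na) =
  allNonAdjacentAfter-sound n false (P ∘ (false ∷_)) all v na
allNonAdjacentAfter-sound (suc n) false P all (true ∷ v) (_ , na) =
  allNonAdjacentAfter-sound n true (P ∘ (true ∷_)) (proj₁ (Equivalence.to T-∧ all)) v na
allNonAdjacentAfter-sound (suc n) false P all (false ∷ v) (_ , na) =
  allNonAdjacentAfter-sound n false (P ∘ (false ∷_))
    (proj₂ (Equivalence.to (T-∧ {allNonAdjacentAfter n true (P ∘ (true ∷_))}) all)) v na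

discrepancyUnder : (ℕ → ℕ) → Collection → ℕ
discrepancyUnder f [] = 0
discrepancyUnder f (((a , b) , (a′ , b′)) ∷ C) = ∣ (f a′ + f b′) - (f a + f b) ∣ + discrepancyUnder f C

discrepancy-cong : ∀ {sw f} → (∀ x → perm sw x ≡ f x) → ∀ C → discrepancy sw C ≡ discrepancyUnder f C
discrepancy-cong e [] = refl
discrepancy-cong e (((a , b) , (a′ , b′)) ∷ C) rewrite e a | e b | e a′ | e b′ =
  cong (_ +_) (discrepancy-cong e C)

companions : Collection
companions = ((1 , 16) , (8 , 9)) ∷ ((2 , 7) , (4 , 5)) ∷ ((3 , 14) , (6 , 11)) ∷ ((10 , 15) , (12 , 13)) ∷ []

companions-balanced : BalancedCompanion companions
companions-balanced = record
  { fourPairs = refl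
  -- insertion sort of the listed elements evaluates to range16
  ; partition = ↭-sym (sort-↭ _)
  ; balanced  = refl ∷ refl ∷ refl ∷ refl ∷ []
  }

companions-bounded : ∀ v → NonAdjacentAfter false v → T (discrepancyUnder (image (extend v 1)) companions ≤ᵇ 6)
companions-bounded = allNonAdjacentAfter-sound 15 false _ tt

isLower-inWindow : ∀ {sw} → SwapCollection sw → ∀ x → isLower sw x ≡ true → 1 ≤ x × x < 1 + 15
isLower-inWindow {sw} sc x _ with x ∈? sw
... | yes x∈sw with All.lookup (SwapCollection.inRange sc) x∈sw
...   | 1≤x , x≤15 = 1≤x , s≤s x≤15

companions-discrepancy≤6 : (sw : List ℕ) → SwapCollection sw → discrepancy sw companions ≤ 6
companions-discrepancy≤6 sw sc =
  subst (_≤ 6) (sym (discrepancy-cong {sw} perm≗window companions))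
    (≤ᵇ⇒≤ _ 6 (companions-bounded window (NonAdjacentAfter-false {b = isLower sw 0} window-nonAdjacent)))
  where
  dss : AllPairs Disjoint sw
  dss = SwapCollection.disjoint sc
  window : Vec Bool 15
  window = restrict (isLower sw) 1 15
  window-nonAdjacent : NonAdjacentAfter (isLower sw 0) window
  window-nonAdjacent = restrict-nonAdjacent {isLower sw} (isLower-nonadjacent dss) 0 15
  perm≗window : ∀ x → perm sw x ≡ image (extend window 1) x
  perm≗window x = trans (perm≗image dss x)
    (image-cong (λ y → sym (extend-restrict (isLower sw) 15 1 y (isLower-inWindow sc y))) x)

lemma3 : Σ Collection (λ C → BalancedCompanion C ×
    ((sw : List ℕ) → SwapCollection sw → discrepancy sw C ≤ 6))
lemma3 = companions , companions-balanced , companions-discrepancy≤6
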